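{- A sequent $\Gamma\Rightarrow\Delta$ is derivable in the calculus QGPM if and only if it is derivable in QGPM without any use of the rule (Cut).
   Context: Language: first-order, with predicate symbols and individual constants but no function symbols; logical symbols $\top,\wedge,\vee,\rightarrow,\forall,\exists$; two disjoint infinite sets of variables: free variables $a,b,c,\dots$ (occurring only free) and bound variables $x,y,z,\dots$ (occurring only bound). $\phi[u/x]$ is the result of substituting $u$ for $x$; $\phi(a)$ denotes $\phi(x)$ with $a$ substituted for $x$. $FreeVar(\Gamma)$ is the set of free variables occurring in $\Gamma$. A sequent $\Gamma\Rightarrow\Delta$ consists of finite sets of formulas $\Gamma,\Delta$. The calculus QGPM (multiple-conclusion first-order primal logic) has axioms $\phi\Rightarrow\phi$ and $\Rightarrow\top$ and rules: ($\wedge$L) from $\Gamma,\phi,\psi\Rightarrow\Delta$ infer $\Gamma,\phi\wedge\psi\Rightarrow\Delta$; ($\wedge$R) from $\Gamma\Rightarrow\Delta,\phi$ and $\Gamma\Rightarrow\Delta,\psi$ infer $\Gamma\Rightarrow\Delta,\phi\wedge\psi$; ($\vee$L) from $\Gamma,\phi\Rightarrow\Delta$ and $\Gamma,\psi\Rightarrow\Delta$ infer $\Gamma,\phi\vee\psi\Rightarrow\Delta$; ($\vee$R) from $\Gamma\Rightarrow\Delta,\phi,\psi$ infer $\Gamma\Rightarrow\Delta,\phi\vee\psi$; ($\rightarrow$L) from $\Gamma,\psi\Rightarrow\Delta$ and $\Gamma\Rightarrow\Delta,\phi$ infer $\Gamma,\phi\rightarrow\psi\Rightarrow\Delta$; ($\rightarrow$Rp)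 from $\Gamma\Rightarrow\psi,\Delta$ infer $\Gamma\Rightarrow\phi\rightarrow\psi,\Delta$; ($\forall$R) from $\Gamma\Rightarrow\Delta,\phi(a)$ infer $\Gamma\Rightarrow\Delta,\forall x\phi(x)$, where $a\notin FreeVar(\Gamma,\Delta)$ (and $a$ does not occur in $\forall x\phi(x)$); ($\forall$L) from $\Gamma,\phi[u/x]\Rightarrow\Delta$ infer $\Gamma,\forall x\phi(x)\Rightarrow\Delta$, $u$ a constant or a free variable; ($\exists$R) from $\Gamma\Rightarrow\Delta,\phi[u/x]$ infer $\Gamma\Rightarrow\Delta,\exists x\phi(x)$, $u$ a constant or a free variable; ($\exists$L) from $\Gamma,\phi(a)\Rightarrow\Delta$ infer $\Gamma,\exists x\phi(x)\Rightarrow\Delta$, where $a$ does not occur in the conclusion; (Weakening) from $\Gamma\Rightarrow\Delta$ infer $\Gamma,\Gamma_1\Rightarrow\Delta,\Delta_1$; (Cut) from $\Gamma\Rightarrow\Delta,\phi$ and $\phi,\Gamma_1\Rightarrow\Delta_1$ infer $\Gamma,\Gamma_1\Rightarrow\Delta,\Delta_1$. -}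

module Defs where

open import Data.Nat using (ℕ; _≟_)
open import Data.Bool using (Bool; true; false; T)
open import Data.List using (List; []; _∷_; _++_)
open import Data.List.Relation.Unary.All using (All)
open import Data.List.Relation.Unary.Any using (Any)
open import Data.List.Membership.Propositional using (_∈_)
open import Relation.Nullary using (¬_; yes; no)
open import Relation.Binary.PropositionalEquality using (_≡_)
open import Function.Bundles using (_⇔_)

data Param : Set where
  const : ℕ → Param
  fvar  : ℕ → Param

data Term : Set where
  par  : Param → Term
  bvar : ℕ → Term

data Formula : Set where
  atom : ℕ → List Term → Formula
  ⊤'   : Formula
  _∧'_ : Formula → Formula → Formula
  _∨'_ : Formula → Formula → Formula
  _⇒'_ : Formula → Formula → Formula
  ∀'   : ℕ → Formula → Formula
  ∃'   : ℕ → Formula → Formula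

substT : Term → Param → ℕ → Term
substT (par p)  u x = par p
substT (bvar y) u x with y ≟ x
... | yes _ = par u
... | no  _ = bvar y

substTs : List Term → Param → ℕ → List Term
substTs []       u x = []
substTs (t ∷ ts) u x = substT t u x ∷ substTs ts u x

_[_/_] : Formula → Param → ℕ → Formula
atom P ts [ u / x ] = atom P (substTs ts u x)
⊤'        [ u / x ] = ⊤'
(φ ∧' ψ)  [ u / x ] = (φ [ u / x ]) ∧' (ψ [ u / x ])
(φ ∨' ψ)  [ u / x ] = (φ [ u / x ]) ∨' (ψ [ u / x ])
(φ ⇒' ψ)  [ u / x ] = (φ [ u / x ]) ⇒' (ψ [ u / x ])
∀' y φ    [ u / x ] with y ≟ x
... | yes _ = ∀' y φ
... | no  _ = ∀' y (φ [ u / x ])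
∃' y φ    [ u / x ] with y ≟ x
... | yes _ = ∃' y φ
... | no  _ = ∃' y (φ [ u / x ])

data OccF (a : ℕ) : Formula → Set where
  atom : ∀ {P ts} → par (fvar a) ∈ ts → OccF a (atom P ts)
  ∧ˡ : ∀ {φ ψ} → OccF a φ → OccF a (φ ∧' ψ)
  ∧ʳ : ∀ {φ ψ} → OccF a ψ → OccF a (φ ∧' ψ)
  ∨ˡ : ∀ {φ ψ} → OccF a φ → OccF a (φ ∨' ψ)
  ∨ʳ : ∀ {φ ψ} → OccF a ψ → OccF a (φ ∨' ψ)
  ⇒ˡ : ∀ {φ ψ} → OccF a φ → OccF a (φ ⇒' ψ)
  ⇒ʳ : ∀ {φ ψ} → OccF a ψ → OccF a (φ ⇒' ψ)
  ∀o : ∀ {x φ} → OccF a φ → OccF a (∀' x φ)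
  ∃o : ∀ {x φ} → OccF a φ → OccF a (∃' x φ)

FreshIn : ℕ → List Formula → Set
FreshIn a Γ = ¬ Any (OccF a) Γ

-- Formulas proper: bound variables occur only bound.
-- ClosedUnder bs φ : every bound-variable occurrence in φ is in bs or
-- bound by a quantifier inside φ.

data TermOK (bs : List ℕ) : Term → Set where
  par  : ∀ {p} → TermOK bs (par p)
  bvar : ∀ {y} → y ∈ bs → TermOK bs (bvar y)

data ClosedUnder (bs : List ℕ) : Formula → Set where
  atom : ∀ {P ts} → All (TermOK bs) ts → ClosedUnder bs (atom P ts)
  ⊤c   : ClosedUnder bs ⊤'
  ∧c   : ∀ {φ ψ} → ClosedUnder bs φ → ClosedUnder bs ψ → ClosedUnder bs (φ ∧' ψ)
  ∨c   : ∀ {φ ψ} → ClosedUnder bs φ → ClosedUnder bs ψ → ClosedUnder bs (φ ∨' ψ)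
  ⇒c   : ∀ {φ ψ} → ClosedUnder bs φ → ClosedUnder bs ψ → ClosedUnder bs (φ ⇒' ψ)
  ∀c   : ∀ {x φ} → ClosedUnder (x ∷ bs) φ → ClosedUnder bs (∀' x φ)
  ∃c   : ∀ {x φ} → ClosedUnder (x ∷ bs) φ → ClosedUnder bs (∃' x φ)

IsFormula : Formula → Set
IsFormula = ClosedUnder []

-- Sequents Γ ⇒ Δ of finite *sets* of formulas, represented by lists;
-- two lists denote the same set iff they have the same members.

SameSet : List Formula → List Formula → Set
SameSet Γ Γ' = ∀ φ → (φ ∈ Γ) ⇔ (φ ∈ Γ')

-- The calculus QGPM.  QGPM c Γ Δ : Γ ⇒ Δ is derivable, where the rule
-- (Cut) may be used iff c ≡ true.

data QGPM (c : Bool) : List Formula → List Formula → Set where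
  set-eq : ∀ {Γ Γ' Δ Δ'} → SameSet Γ Γ' → SameSet Δ Δ' →
           QGPM c Γ Δ → QGPM c Γ' Δ'
  ax     : ∀ {φ} → IsFormula φ → QGPM c (φ ∷ []) (φ ∷ [])
  ax⊤    : QGPM c [] (⊤' ∷ [])
  ∧L     : ∀ {Γ Δ φ ψ} → QGPM c (φ ∷ ψ ∷ Γ) Δ → QGPM c ((φ ∧' ψ) ∷ Γ) Δ
  ∧R     : ∀ {Γ Δ φ ψ} → QGPM c Γ (φ ∷ Δ) → QGPM c Γ (ψ ∷ Δ) →
           QGPM c Γ ((φ ∧' ψ) ∷ Δ)
  ∨L     : ∀ {Γ Δ φ ψ} → QGPM c (φ ∷ Γ) Δ → QGPM c (ψ ∷ Γ) Δ →
           QGPM c ((φ ∨' ψ) ∷ Γ) Δ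
  ∨R     : ∀ {Γ Δ φ ψ} → QGPM c Γ (φ ∷ ψ ∷ Δ) → QGPM c Γ ((φ ∨' ψ) ∷ Δ)
  ⇒L     : ∀ {Γ Δ φ ψ} → QGPM c (ψ ∷ Γ) Δ → QGPM c Γ (φ ∷ Δ) →
           QGPM c ((φ ⇒' ψ) ∷ Γ) Δ
  ⇒Rp    : ∀ {Γ Δ φ ψ} → IsFormula φ → QGPM c Γ (ψ ∷ Δ) →
           QGPM c Γ ((φ ⇒' ψ) ∷ Δ)
  ∀R     : ∀ {Γ Δ x φ a} → FreshIn a Γ → FreshIn a Δ → ¬ OccF a (∀' x φ) →
           QGPM c Γ ((φ [ fvar a / x ]) ∷ Δ) → QGPM c Γ (∀' x φ ∷ Δ)
  ∀L     : ∀ {Γ Δ x φ} (u : Param) →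
           QGPM c ((φ [ u / x ]) ∷ Γ) Δ → QGPM c (∀' x φ ∷ Γ) Δ
  ∃R     : ∀ {Γ Δ x φ} (u : Param) →
           QGPM c Γ ((φ [ u / x ]) ∷ Δ) → QGPM c Γ (∃' x φ ∷ Δ)
  ∃L     : ∀ {Γ Δ x φ a} → FreshIn a (∃' x φ ∷ Γ) → FreshIn a Δ →
           QGPM c ((φ [ fvar a / x ]) ∷ Γ) Δ → QGPM c (∃' x φ ∷ Γ) Δ
  weak   : ∀ {Γ Δ} (Γ₁ Δ₁ : List Formula) → All IsFormula Γ₁ → All IsFormula Δ₁ →
           QGPM c Γ Δ → QGPM c (Γ ++ Γ₁) (Δ ++ Δ₁)
  cut    : ∀ {Γ Δ Γ₁ Δ₁ φ} → T c → IsFormula φ →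
           QGPM c Γ (φ ∷ Δ) → QGPM c (φ ∷ Γ₁) Δ₁ → QGPM c (Γ ++ Γ₁) (Δ ++ Δ₁)

-- Cut is eliminated through an auxiliary calculus _⊢_ in which every rule keeps its principal
-- formula in the sequent (so weakening and contraction are built in) and the eigenvariable rules
-- ∀R and ∃L are ω-rules with one premise for every parameter.  A QGPM derivation translates into
-- _⊢_ by renaming its eigenvariables, a cut-free _⊢_ derivation translates back into QGPM without
-- cut, and in _⊢_ cut is admissible by induction on the cut formula: one first follows the
-- derivation of the cut formula φ until φ is introduced on the right, and then the derivation using
-- φ until φ is introduced on the left, where the cut reduces to cuts on smaller formulas.  The
-- ω-rules make the quantifier reductions immediate, and since primal ⇒R has only the premise ψ,
-- the cut on φ ⇒' ψ against ⇒L reduces to a single cut on ψ.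

module Submission where

open import Data.Bool using (true; false)
open import Data.Empty using (⊥; ⊥-elim)
open import Data.List using (List; []; _∷_; _++_; map)
open import Data.List.Properties using (map-cong; map-cong-local; map-id)
open import Data.List.Membership.Propositional using (_∈_; lose)
open import Data.List.Membership.Propositional.Properties using (∈-map⁺; ∈-++⁺ˡ; ∈-++⁺ʳ)
open import Data.List.Relation.Binary.Subset.Propositional using (_⊆_)
open import Data.List.Relation.Binary.Subset.Propositional.Properties using (⊆-refl; ∷⁺ʳ; ∈-∷⁺ʳ; xs⊆xs++ys; xs⊆ys++xs; Any-resp-⊆; All-resp-⊇)
open import Data.List.Relation.Unary.All as All using (All; []; _∷_)
open import Data.List.Relation.Unary.All.Properties using (++⁺; ¬Any⇒All¬)
open import Data.List.Relation.Unary.Any using (Any; here; there)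
open import Data.Nat using (ℕ; zero; suc; _≟_; _+_; _⊔_; _≤_; _<_; s≤s)
open import Data.Nat.Induction using (<-wellFounded)
open import Data.Nat.Properties using (m≤m⊔n; m≤n⇒m≤n⊔o; m≤n⇒m≤o⊔n; 1+n≰n; m≤m+n; m≤n+m; ≤-reflexive)
open import Data.Product using (Σ; ∃-syntax; _×_; _,_)
open import Data.Unit using (⊤; tt)
open import Defs
open import Function using (_∘_)
open import Function.Bundles using (_⇔_; mk⇔; Equivalence)
open import Induction.WellFounded using (Acc; acc)
open import Relation.Binary.PropositionalEquality using (_≡_; refl; trans; cong; cong₂; subst; subst₂; module ≡-Reasoning)
open import Relation.Nullary using (¬_; yes; no)

∷-swap-⊆ : ∀ {a} {A : Set a} {x y : A} {xs} → x ∷ y ∷ xs ⊆ y ∷ x ∷ xs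
∷-swap-⊆ = ∈-∷⁺ʳ (there (here refl)) (∷⁺ʳ _ there)

∷-contract-⊆ : ∀ {a} {A : Set a} {x : A} {xs} → x ∈ xs → x ∷ xs ⊆ xs
∷-contract-⊆ x∈xs = ∈-∷⁺ʳ x∈xs ⊆-refl

∷-extend-⊆ : ∀ {a} {A : Set a} {x y : A} {xs ys} → xs ⊆ x ∷ ys → y ∷ xs ⊆ x ∷ y ∷ ys
∷-extend-⊆ xs⊆ = ∈-∷⁺ʳ (there (here refl)) (∷⁺ʳ _ there ∘ xs⊆)

TermOK-mono : ∀ {bs bs' t} → bs ⊆ bs' → TermOK bs t → TermOK bs' t
TermOK-mono bs⊆ par      = par
TermOK-mono bs⊆ (bvar m) = bvar (bs⊆ m)

ClosedUnder-mono : ∀ {bs bs' φ} → bs ⊆ bs' → ClosedUnder bs φ → ClosedUnder bs' φ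
ClosedUnder-mono bs⊆ (atom ts) = atom (All.map (TermOK-mono bs⊆) ts)
ClosedUnder-mono bs⊆ ⊤c        = ⊤c
ClosedUnder-mono bs⊆ (∧c a b)  = ∧c (ClosedUnder-mono bs⊆ a) (ClosedUnder-mono bs⊆ b)
ClosedUnder-mono bs⊆ (∨c a b)  = ∨c (ClosedUnder-mono bs⊆ a) (ClosedUnder-mono bs⊆ b)
ClosedUnder-mono bs⊆ (⇒c a b)  = ⇒c (ClosedUnder-mono bs⊆ a) (ClosedUnder-mono bs⊆ b)
ClosedUnder-mono bs⊆ (∀c a)    = ∀c (ClosedUnder-mono (∷⁺ʳ _ bs⊆) a)
ClosedUnder-mono bs⊆ (∃c a)    = ∃c (ClosedUnder-mono (∷⁺ʳ _ bs⊆) a)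

TermOK-subst⁺ : ∀ bs x u t → TermOK (x ∷ bs) t → TermOK bs (substT t u x)
TermOK-subst⁺ bs x u (par p) par = par
TermOK-subst⁺ bs x u (bvar y) (bvar m) with y ≟ x
TermOK-subst⁺ bs x u (bvar y) (bvar m)           | yes _   = par
TermOK-subst⁺ bs x u (bvar y) (bvar (here y≡x))  | no y≢x  = ⊥-elim (y≢x y≡x)
TermOK-subst⁺ bs x u (bvar y) (bvar (there y∈)) | no _    = bvar y∈

TermOK-subst⁻ : ∀ bs x u t → TermOK bs (substT t u x) → TermOK (x ∷ bs) t
TermOK-subst⁻ bs x u (par p) _ = par
TermOK-subst⁻ bs x u (bvar y) ok with y ≟ x
TermOK-subst⁻ bs x u (bvar y) ok         | yes y≡x = bvar (here y≡x)
TermOK-subst⁻ bs x u (bvar y) (bvar y∈) | no _    = bvar (there y∈)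

TermOKs-subst⁺ : ∀ bs x u ts → All (TermOK (x ∷ bs)) ts → All (TermOK bs) (substTs ts u x)
TermOKs-subst⁺ bs x u []       []       = []
TermOKs-subst⁺ bs x u (t ∷ ts) (k ∷ ks) = TermOK-subst⁺ bs x u t k ∷ TermOKs-subst⁺ bs x u ts ks

TermOKs-subst⁻ : ∀ bs x u ts → All (TermOK bs) (substTs ts u x) → All (TermOK (x ∷ bs)) ts
TermOKs-subst⁻ bs x u []       []       = []
TermOKs-subst⁻ bs x u (t ∷ ts) (k ∷ ks) = TermOK-subst⁻ bs x u t k ∷ TermOKs-subst⁻ bs x u ts ks

ClosedUnder-subst⁺ : ∀ bs x u φ → ClosedUnder (x ∷ bs) φ → ClosedUnder bs (φ [ u / x ])
ClosedUnder-subst⁺ bs x u (atom P ts) (atom ks) = atom (TermOKs-subst⁺ bs x u ts ks)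
ClosedUnder-subst⁺ bs x u ⊤'        ⊤c        = ⊤c
ClosedUnder-subst⁺ bs x u (A ∧' B)  (∧c a b)  = ∧c (ClosedUnder-subst⁺ bs x u A a) (ClosedUnder-subst⁺ bs x u B b)
ClosedUnder-subst⁺ bs x u (A ∨' B)  (∨c a b)  = ∨c (ClosedUnder-subst⁺ bs x u A a) (ClosedUnder-subst⁺ bs x u B b)
ClosedUnder-subst⁺ bs x u (A ⇒' B)  (⇒c a b)  = ⇒c (ClosedUnder-subst⁺ bs x u A a) (ClosedUnder-subst⁺ bs x u B b)
ClosedUnder-subst⁺ bs x u (∀' y A) (∀c a) with y ≟ x
... | yes refl = ∀c (ClosedUnder-mono (∷-contract-⊆ (here refl)) a)
... | no _     = ∀c (ClosedUnder-subst⁺ (y ∷ bs) x u A (ClosedUnder-mono ∷-swap-⊆ a))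
ClosedUnder-subst⁺ bs x u (∃' y A) (∃c a) with y ≟ x
... | yes refl = ∃c (ClosedUnder-mono (∷-contract-⊆ (here refl)) a)
... | no _     = ∃c (ClosedUnder-subst⁺ (y ∷ bs) x u A (ClosedUnder-mono ∷-swap-⊆ a))

ClosedUnder-subst⁻ : ∀ bs x u φ → ClosedUnder bs (φ [ u / x ]) → ClosedUnder (x ∷ bs) φ
ClosedUnder-subst⁻ bs x u (atom P ts) (atom ks) = atom (TermOKs-subst⁻ bs x u ts ks)
ClosedUnder-subst⁻ bs x u ⊤'        ⊤c        = ⊤c
ClosedUnder-subst⁻ bs x u (A ∧' B)  (∧c a b)  = ∧c (ClosedUnder-subst⁻ bs x u A a) (ClosedUnder-subst⁻ bs x u B b)
ClosedUnder-subst⁻ bs x u (A ∨' B)  (∨c a b)  = ∨c (ClosedUnder-subst⁻ bs x u A a) (ClosedUnder-subst⁻ bs x u B b)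
ClosedUnder-subst⁻ bs x u (A ⇒' B)  (⇒c a b)  = ⇒c (ClosedUnder-subst⁻ bs x u A a) (ClosedUnder-subst⁻ bs x u B b)
ClosedUnder-subst⁻ bs x u (∀' y A) c with y ≟ x
ClosedUnder-subst⁻ bs x u (∀' y A) c      | yes refl = ClosedUnder-mono there c
ClosedUnder-subst⁻ bs x u (∀' y A) (∀c a) | no _     = ∀c (ClosedUnder-mono ∷-swap-⊆ (ClosedUnder-subst⁻ (y ∷ bs) x u A a))
ClosedUnder-subst⁻ bs x u (∃' y A) c with y ≟ x
ClosedUnder-subst⁻ bs x u (∃' y A) c      | yes refl = ClosedUnder-mono there c
ClosedUnder-subst⁻ bs x u (∃' y A) (∃c a) | no _     = ∃c (ClosedUnder-mono ∷-swap-⊆ (ClosedUnder-subst⁻ (y ∷ bs) x u A a))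

SameSet⇒⊆ : ∀ {Γ Γ'} → SameSet Γ Γ' → Γ ⊆ Γ'
SameSet⇒⊆ Γ≈Γ' = Equivalence.to (Γ≈Γ' _)

SameSet⇒⊇ : ∀ {Γ Γ'} → SameSet Γ Γ' → Γ' ⊆ Γ
SameSet⇒⊇ Γ≈Γ' = Equivalence.from (Γ≈Γ' _)

SameSet-refl : ∀ {Γ} → SameSet Γ Γ
SameSet-refl φ = mk⇔ (λ φ∈ → φ∈) (λ φ∈ → φ∈)

SameSet-absorb : ∀ {φ Γ} → φ ∈ Γ → SameSet (φ ∷ Γ) Γ
SameSet-absorb φ∈Γ ψ = mk⇔ (∷-contract-⊆ φ∈Γ) there

QGPM-wf : ∀ {c Γ Δ} → QGPM c Γ Δ → All IsFormula Γ × All IsFormula Δ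
QGPM-wf (set-eq Γ≈ Δ≈ D) with QGPM-wf D
... | wΓ , wΔ = All-resp-⊇ (SameSet⇒⊇ Γ≈) wΓ , All-resp-⊇ (SameSet⇒⊇ Δ≈) wΔ
QGPM-wf (ax w) = w ∷ [] , w ∷ []
QGPM-wf ax⊤    = [] , ⊤c ∷ []
QGPM-wf (∧L D) with QGPM-wf D
... | a ∷ b ∷ wΓ , wΔ = ∧c a b ∷ wΓ , wΔ
QGPM-wf (∧R D E) with QGPM-wf D | QGPM-wf E
... | wΓ , a ∷ wΔ | _ , b ∷ _ = wΓ , ∧c a b ∷ wΔ
QGPM-wf (∨L D E) with QGPM-wf D | QGPM-wf E
... | a ∷ wΓ , wΔ | b ∷ _ , _ = ∨c a b ∷ wΓ , wΔ
QGPM-wf (∨R D) with QGPM-wf D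
... | wΓ , a ∷ b ∷ wΔ = wΓ , ∨c a b ∷ wΔ
QGPM-wf (⇒L D E) with QGPM-wf D | QGPM-wf E
... | b ∷ wΓ , wΔ | _ , a ∷ _ = ⇒c a b ∷ wΓ , wΔ
QGPM-wf (⇒Rp a D) with QGPM-wf D
... | wΓ , b ∷ wΔ = wΓ , ⇒c a b ∷ wΔ
QGPM-wf (∀R {x = x} {φ = A} {a = a} _ _ _ D) with QGPM-wf D
... | wΓ , w ∷ wΔ = wΓ , ∀c (ClosedUnder-subst⁻ [] x (fvar a) A w) ∷ wΔ
QGPM-wf (∀L {x = x} {φ = A} u D) with QGPM-wf D
... | w ∷ wΓ , wΔ = ∀c (ClosedUnder-subst⁻ [] x u A w) ∷ wΓ , wΔ
QGPM-wf (∃R {x = x} {φ = A} u D) with QGPM-wf D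
... | wΓ , w ∷ wΔ = wΓ , ∃c (ClosedUnder-subst⁻ [] x u A w) ∷ wΔ
QGPM-wf (∃L {x = x} {φ = A} {a = a} _ _ D) with QGPM-wf D
... | w ∷ wΓ , wΔ = ∃c (ClosedUnder-subst⁻ [] x (fvar a) A w) ∷ wΓ , wΔ
QGPM-wf (weak Γ₁ Δ₁ wΓ₁ wΔ₁ D) with QGPM-wf D
... | wΓ , wΔ = ++⁺ wΓ wΓ₁ , ++⁺ wΔ wΔ₁
QGPM-wf (cut _ _ D E) with QGPM-wf D | QGPM-wf E
... | wΓ , _ ∷ wΔ | _ ∷ wΓ₁ , wΔ₁ = ++⁺ wΓ wΓ₁ , ++⁺ wΔ wΔ₁

Sub : Set
Sub = ℕ → Param

subP : Sub → Param → Param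
subP σ (const k) = const k
subP σ (fvar a)  = σ a

subT : Sub → Term → Term
subT σ (par p)  = par (subP σ p)
subT σ (bvar y) = bvar y

subF : Sub → Formula → Formula
subF σ (atom P ts) = atom P (map (subT σ) ts)
subF σ ⊤'          = ⊤'
subF σ (A ∧' B)    = subF σ A ∧' subF σ B
subF σ (A ∨' B)    = subF σ A ∨' subF σ B
subF σ (A ⇒' B)    = subF σ A ⇒' subF σ B
subF σ (∀' x A)    = ∀' x (subF σ A)
subF σ (∃' x A)    = ∃' x (subF σ A)

subL : Sub → List Formula → List Formula
subL σ = map (subF σ)

subT-[/] : ∀ σ t u x → subT σ (substT t u x) ≡ substT (subT σ t) (subP σ u) x
subT-[/] σ (par p)  u x = refl
subT-[/] σ (bvar y) u x with y ≟ x
... | yes _ = refl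
... | no _  = refl

subTs-[/] : ∀ σ ts u x → map (subT σ) (substTs ts u x) ≡ substTs (map (subT σ) ts) (subP σ u) x
subTs-[/] σ []       u x = refl
subTs-[/] σ (t ∷ ts) u x = cong₂ _∷_ (subT-[/] σ t u x) (subTs-[/] σ ts u x)

subF-[/] : ∀ σ φ u x → subF σ (φ [ u / x ]) ≡ subF σ φ [ subP σ u / x ]
subF-[/] σ (atom P ts) u x = cong (atom P) (subTs-[/] σ ts u x)
subF-[/] σ ⊤'          u x = refl
subF-[/] σ (A ∧' B)    u x = cong₂ _∧'_ (subF-[/] σ A u x) (subF-[/] σ B u x)
subF-[/] σ (A ∨' B)    u x = cong₂ _∨'_ (subF-[/] σ A u x) (subF-[/] σ B u x)
subF-[/] σ (A ⇒' B)    u x = cong₂ _⇒'_ (subF-[/] σ A u x) (subF-[/] σ B u x)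
subF-[/] σ (∀' y A)    u x with y ≟ x
... | yes _ = refl
... | no _  = cong (∀' y) (subF-[/] σ A u x)
subF-[/] σ (∃' y A)    u x with y ≟ x
... | yes _ = refl
... | no _  = cong (∃' y) (subF-[/] σ A u x)

subTs-cong : ∀ {σ τ} ts → (∀ b → par (fvar b) ∈ ts → σ b ≡ τ b) → map (subT σ) ts ≡ map (subT τ) ts
subTs-cong {σ} {τ} ts σ≗τ = map-cong-local (All.tabulate agree)
  where
  agree : ∀ {t} → t ∈ ts → subT σ t ≡ subT τ t
  agree {par (const k)} _ = refl
  agree {par (fvar b)}  m = cong par (σ≗τ b m)
  agree {bvar y}        _ = refl

subF-cong : ∀ {σ τ} φ → (∀ b → OccF b φ → σ b ≡ τ b) → subF σ φ ≡ subF τ φ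
subF-cong (atom P ts) σ≗τ = cong (atom P) (subTs-cong ts (λ b → σ≗τ b ∘ atom))
subF-cong ⊤'          σ≗τ = refl
subF-cong (A ∧' B)    σ≗τ = cong₂ _∧'_ (subF-cong A (λ b → σ≗τ b ∘ ∧ˡ)) (subF-cong B (λ b → σ≗τ b ∘ ∧ʳ))
subF-cong (A ∨' B)    σ≗τ = cong₂ _∨'_ (subF-cong A (λ b → σ≗τ b ∘ ∨ˡ)) (subF-cong B (λ b → σ≗τ b ∘ ∨ʳ))
subF-cong (A ⇒' B)    σ≗τ = cong₂ _⇒'_ (subF-cong A (λ b → σ≗τ b ∘ ⇒ˡ)) (subF-cong B (λ b → σ≗τ b ∘ ⇒ʳ))
subF-cong (∀' x A)    σ≗τ = cong (∀' x) (subF-cong A (λ b → σ≗τ b ∘ ∀o))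
subF-cong (∃' x A)    σ≗τ = cong (∃' x) (subF-cong A (λ b → σ≗τ b ∘ ∃o))

subT-id : ∀ t → subT fvar t ≡ t
subT-id (par (const k)) = refl
subT-id (par (fvar a))  = refl
subT-id (bvar y)        = refl

subF-id : ∀ φ → subF fvar φ ≡ φ
subF-id (atom P ts) = cong (atom P) (trans (map-cong subT-id ts) (map-id ts))
subF-id ⊤'          = refl
subF-id (A ∧' B)    = cong₂ _∧'_ (subF-id A) (subF-id B)
subF-id (A ∨' B)    = cong₂ _∨'_ (subF-id A) (subF-id B)
subF-id (A ⇒' B)    = cong₂ _⇒'_ (subF-id A) (subF-id B)
subF-id (∀' x A)    = cong (∀' x) (subF-id A)
subF-id (∃' x A)    = cong (∃' x) (subF-id A)

subL-id : ∀ Γ → subL fvar Γ ≡ Γ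
subL-id Γ = trans (map-cong subF-id Γ) (map-id Γ)

update : Sub → ℕ → Param → Sub
update σ a c b with b ≟ a
... | yes _ = c
... | no _  = σ b

update-≡ : ∀ σ a c → update σ a c a ≡ c
update-≡ σ a c with a ≟ a
... | yes _   = refl
... | no a≢a = ⊥-elim (a≢a refl)

update-≢ : ∀ σ {a} c {b} → ¬ b ≡ a → update σ a c b ≡ σ b
update-≢ σ {a} c {b} b≢a with b ≟ a
... | yes b≡a = ⊥-elim (b≢a b≡a)
... | no _    = refl

subF-update-fresh : ∀ σ {a} c {φ} → ¬ OccF a φ → subF (update σ a c) φ ≡ subF σ φ
subF-update-fresh σ c {φ} a∉φ = subF-cong φ (λ b b∈φ → update-≢ σ c (λ { refl → a∉φ b∈φ }))

subL-update-fresh : ∀ σ {a} c Γ → FreshIn a Γ → subL (update σ a c) Γ ≡ subL σ Γ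
subL-update-fresh σ c Γ a∉Γ = map-cong-local (All.map (subF-update-fresh σ c) (¬Any⇒All¬ Γ a∉Γ))

subF-eigen : ∀ σ {a} c φ x → ¬ OccF a φ → subF (update σ a c) (φ [ fvar a / x ]) ≡ subF σ φ [ c / x ]
subF-eigen σ {a} c φ x a∉φ = begin
  subF (update σ a c) (φ [ fvar a / x ])       ≡⟨ subF-[/] (update σ a c) φ (fvar a) x ⟩
  subF (update σ a c) φ [ update σ a c a / x ] ≡⟨ cong₂ (λ ψ u → ψ [ u / x ]) (subF-update-fresh σ c a∉φ) (update-≡ σ a c) ⟩
  subF σ φ [ c / x ]                           ∎
  where open ≡-Reasoning

maxT : Term → ℕ
maxT (par (const _)) = zero
maxT (par (fvar a))  = a
maxT (bvar _)        = zero

maxTs : List Term → ℕ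
maxTs []       = zero
maxTs (t ∷ ts) = maxT t ⊔ maxTs ts

maxF : Formula → ℕ
maxF (atom P ts) = maxTs ts
maxF ⊤'          = zero
maxF (A ∧' B)    = maxF A ⊔ maxF B
maxF (A ∨' B)    = maxF A ⊔ maxF B
maxF (A ⇒' B)    = maxF A ⊔ maxF B
maxF (∀' x A)    = maxF A
maxF (∃' x A)    = maxF A

maxL : List Formula → ℕ
maxL []      = zero
maxL (φ ∷ Γ) = maxF φ ⊔ maxL Γ

∈⇒≤maxTs : ∀ {a ts} → par (fvar a) ∈ ts → a ≤ maxTs ts
∈⇒≤maxTs {a} (here refl) = m≤m⊔n a _
∈⇒≤maxTs {ts = t ∷ _} (there a∈) = m≤n⇒m≤o⊔n (maxT t) (∈⇒≤maxTs a∈)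

OccF⇒≤maxF : ∀ {a φ} → OccF a φ → a ≤ maxF φ
OccF⇒≤maxF (atom a∈) = ∈⇒≤maxTs a∈
OccF⇒≤maxF (∧ˡ o) = m≤n⇒m≤n⊔o _ (OccF⇒≤maxF o)
OccF⇒≤maxF (∧ʳ o) = m≤n⇒m≤o⊔n _ (OccF⇒≤maxF o)
OccF⇒≤maxF (∨ˡ o) = m≤n⇒m≤n⊔o _ (OccF⇒≤maxF o)
OccF⇒≤maxF (∨ʳ o) = m≤n⇒m≤o⊔n _ (OccF⇒≤maxF o)
OccF⇒≤maxF (⇒ˡ o) = m≤n⇒m≤n⊔o _ (OccF⇒≤maxF o)
OccF⇒≤maxF (⇒ʳ o) = m≤n⇒m≤o⊔n _ (OccF⇒≤maxF o)
OccF⇒≤maxF (∀o o) = OccF⇒≤maxF o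
OccF⇒≤maxF (∃o o) = OccF⇒≤maxF o

AnyOccF⇒≤maxL : ∀ {a Γ} → Any (OccF a) Γ → a ≤ maxL Γ
AnyOccF⇒≤maxL (here o)  = m≤n⇒m≤n⊔o _ (OccF⇒≤maxF o)
AnyOccF⇒≤maxL {Γ = φ ∷ _} (there o) = m≤n⇒m≤o⊔n (maxF φ) (AnyOccF⇒≤maxL o)

suc-maxL-fresh : ∀ Γ → FreshIn (suc (maxL Γ)) Γ
suc-maxL-fresh Γ = 1+n≰n ∘ AnyOccF⇒≤maxL

fresh₂ : ∀ Γ Δ → ∃[ a ] FreshIn a Γ × FreshIn a Δ
fresh₂ Γ Δ = suc (maxL (Γ ++ Δ))
           , suc-maxL-fresh (Γ ++ Δ) ∘ Any-resp-⊆ (xs⊆xs++ys Γ Δ)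
           , suc-maxL-fresh (Γ ++ Δ) ∘ Any-resp-⊆ (xs⊆ys++xs Δ Γ)

-- The auxiliary calculus

infix 4 _⊢_

data _⊢_ : List Formula → List Formula → Set where
  ax : ∀ {Γ Δ φ} → φ ∈ Γ → φ ∈ Δ → Γ ⊢ Δ
  ⊤R : ∀ {Γ Δ} → ⊤' ∈ Δ → Γ ⊢ Δ
  ∧L : ∀ {Γ Δ A B} → (A ∧' B) ∈ Γ → A ∷ B ∷ Γ ⊢ Δ → Γ ⊢ Δ
  ∧R : ∀ {Γ Δ A B} → (A ∧' B) ∈ Δ → Γ ⊢ A ∷ Δ → Γ ⊢ B ∷ Δ → Γ ⊢ Δ
  ∨L : ∀ {Γ Δ A B} → (A ∨' B) ∈ Γ → A ∷ Γ ⊢ Δ → B ∷ Γ ⊢ Δ → Γ ⊢ Δ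
  ∨R : ∀ {Γ Δ A B} → (A ∨' B) ∈ Δ → Γ ⊢ A ∷ B ∷ Δ → Γ ⊢ Δ
  ⇒L : ∀ {Γ Δ A B} → (A ⇒' B) ∈ Γ → B ∷ Γ ⊢ Δ → Γ ⊢ A ∷ Δ → Γ ⊢ Δ
  ⇒R : ∀ {Γ Δ A B} → (A ⇒' B) ∈ Δ → Γ ⊢ B ∷ Δ → Γ ⊢ Δ
  ∀R : ∀ {Γ Δ x A} → ∀' x A ∈ Δ → (∀ u → Γ ⊢ A [ u / x ] ∷ Δ) → Γ ⊢ Δ
  ∀L : ∀ {Γ Δ x A} → ∀' x A ∈ Γ → (u : Param) → A [ u / x ] ∷ Γ ⊢ Δ → Γ ⊢ Δ
  ∃R : ∀ {Γ Δ x A} → ∃' x A ∈ Δ → (u : Param) → Γ ⊢ A [ u / x ] ∷ Δ → Γ ⊢ Δ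
  ∃L : ∀ {Γ Δ x A} → ∃' x A ∈ Γ → (∀ u → A [ u / x ] ∷ Γ ⊢ Δ) → Γ ⊢ Δ

⊢-weaken : ∀ {Γ Δ Γ' Δ'} → Γ ⊆ Γ' → Δ ⊆ Δ' → Γ ⊢ Δ → Γ' ⊢ Δ'
⊢-weaken Γ⊆ Δ⊆ (ax φ∈Γ φ∈Δ) = ax (Γ⊆ φ∈Γ) (Δ⊆ φ∈Δ)
⊢-weaken Γ⊆ Δ⊆ (⊤R k)       = ⊤R (Δ⊆ k)
⊢-weaken Γ⊆ Δ⊆ (∧L m D)     = ∧L (Γ⊆ m) (⊢-weaken (∷⁺ʳ _ (∷⁺ʳ _ Γ⊆)) Δ⊆ D)
⊢-weaken Γ⊆ Δ⊆ (∧R k D E)   = ∧R (Δ⊆ k) (⊢-weaken Γ⊆ (∷⁺ʳ _ Δ⊆) D) (⊢-weaken Γ⊆ (∷⁺ʳ _ Δ⊆) E)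
⊢-weaken Γ⊆ Δ⊆ (∨L m D E)   = ∨L (Γ⊆ m) (⊢-weaken (∷⁺ʳ _ Γ⊆) Δ⊆ D) (⊢-weaken (∷⁺ʳ _ Γ⊆) Δ⊆ E)
⊢-weaken Γ⊆ Δ⊆ (∨R k D)     = ∨R (Δ⊆ k) (⊢-weaken Γ⊆ (∷⁺ʳ _ (∷⁺ʳ _ Δ⊆)) D)
⊢-weaken Γ⊆ Δ⊆ (⇒L m D E)   = ⇒L (Γ⊆ m) (⊢-weaken (∷⁺ʳ _ Γ⊆) Δ⊆ D) (⊢-weaken Γ⊆ (∷⁺ʳ _ Δ⊆) E)
⊢-weaken Γ⊆ Δ⊆ (⇒R k D)     = ⇒R (Δ⊆ k) (⊢-weaken Γ⊆ (∷⁺ʳ _ Δ⊆) D)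
⊢-weaken Γ⊆ Δ⊆ (∀R k F)     = ∀R (Δ⊆ k) (λ u → ⊢-weaken Γ⊆ (∷⁺ʳ _ Δ⊆) (F u))
⊢-weaken Γ⊆ Δ⊆ (∀L m u D)   = ∀L (Γ⊆ m) u (⊢-weaken (∷⁺ʳ _ Γ⊆) Δ⊆ D)
⊢-weaken Γ⊆ Δ⊆ (∃R k u D)   = ∃R (Δ⊆ k) u (⊢-weaken Γ⊆ (∷⁺ʳ _ Δ⊆) D)
⊢-weaken Γ⊆ Δ⊆ (∃L m F)     = ∃L (Γ⊆ m) (λ u → ⊢-weaken (∷⁺ʳ _ Γ⊆) Δ⊆ (F u))

⊢-weakenˡ : ∀ {Γ Δ Γ'} → Γ ⊆ Γ' → Γ ⊢ Δ → Γ' ⊢ Δ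
⊢-weakenˡ Γ⊆ = ⊢-weaken Γ⊆ ⊆-refl

⊢-weakenʳ : ∀ {Γ Δ Δ'} → Δ ⊆ Δ' → Γ ⊢ Δ → Γ ⊢ Δ'
⊢-weakenʳ = ⊢-weaken ⊆-refl

⊢-sub : ∀ σ {Γ Δ} → Γ ⊢ Δ → subL σ Γ ⊢ subL σ Δ
⊢-sub σ (ax φ∈Γ φ∈Δ) = ax (∈-map⁺ _ φ∈Γ) (∈-map⁺ _ φ∈Δ)
⊢-sub σ (⊤R k)       = ⊤R (∈-map⁺ _ k)
⊢-sub σ (∧L m D)     = ∧L (∈-map⁺ _ m) (⊢-sub σ D)
⊢-sub σ (∧R k D E)   = ∧R (∈-map⁺ _ k) (⊢-sub σ D) (⊢-sub σ E)
⊢-sub σ (∨L m D E)   = ∨L (∈-map⁺ _ m) (⊢-sub σ D) (⊢-sub σ E)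
⊢-sub σ (∨R k D)     = ∨R (∈-map⁺ _ k) (⊢-sub σ D)
⊢-sub σ (⇒L m D E)   = ⇒L (∈-map⁺ _ m) (⊢-sub σ D) (⊢-sub σ E)
⊢-sub σ (⇒R k D)     = ⇒R (∈-map⁺ _ k) (⊢-sub σ D)
⊢-sub σ {Γ} {Δ} (∀L {x = x} {A} m u D) =
  ∀L (∈-map⁺ _ m) (subP σ u) (subst (λ B → B ∷ subL σ Γ ⊢ subL σ Δ) (subF-[/] σ A u x) (⊢-sub σ D))
⊢-sub σ {Γ} {Δ} (∃R {x = x} {A} k u D) =
  ∃R (∈-map⁺ _ k) (subP σ u) (subst (λ B → subL σ Γ ⊢ B ∷ subL σ Δ) (subF-[/] σ A u x) (⊢-sub σ D))
-- σ need not be onto, so the premise for c is obtained from the one for a fresh a by sending a to c.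
⊢-sub σ {Γ} {Δ} (∀R {x = x} {A} k F) = ∀R (∈-map⁺ _ k) λ c →
  let a , a∉Γ , a∉Δ = fresh₂ Γ Δ in
  subst₂ _⊢_ (subL-update-fresh σ c Γ a∉Γ)
             (cong₂ _∷_ (subF-eigen σ c A x (a∉Δ ∘ lose k ∘ ∀o)) (subL-update-fresh σ c Δ a∉Δ))
             (⊢-sub (update σ a c) (F (fvar a)))
⊢-sub σ {Γ} {Δ} (∃L {x = x} {A} m F) = ∃L (∈-map⁺ _ m) λ c →
  let a , a∉Γ , a∉Δ = fresh₂ Γ Δ in
  subst₂ _⊢_ (cong₂ _∷_ (subF-eigen σ c A x (a∉Γ ∘ lose m ∘ ∃o)) (subL-update-fresh σ c Γ a∉Γ))
             (subL-update-fresh σ c Δ a∉Δ)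
             (⊢-sub (update σ a c) (F (fvar a)))

subL-eigen-id : ∀ {a} c Γ → FreshIn a Γ → subL (update fvar a c) Γ ≡ Γ
subL-eigen-id c Γ a∉Γ = trans (subL-update-fresh fvar c Γ a∉Γ) (subL-id Γ)

subF-eigen-inst : ∀ {a} c A x → ¬ OccF a A → subF (update fvar a c) (A [ fvar a / x ]) ≡ A [ c / x ]
subF-eigen-inst c A x a∉A = trans (subF-eigen fvar c A x a∉A) (cong (λ B → B [ c / x ]) (subF-id A))

⊢-eigenʳ : ∀ {Γ Δ a} x A c → FreshIn a Γ → FreshIn a Δ → ¬ OccF a A →
           Γ ⊢ A [ fvar a / x ] ∷ Δ → Γ ⊢ A [ c / x ] ∷ Δ
⊢-eigenʳ {Γ} {Δ} {a} x A c a∉Γ a∉Δ a∉A D =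
  subst₂ _⊢_ (subL-eigen-id c Γ a∉Γ) (cong₂ _∷_ (subF-eigen-inst c A x a∉A) (subL-eigen-id c Δ a∉Δ))
             (⊢-sub (update fvar a c) D)

⊢-eigenˡ : ∀ {Γ Δ a} x A c → FreshIn a Γ → FreshIn a Δ → ¬ OccF a A →
           A [ fvar a / x ] ∷ Γ ⊢ Δ → A [ c / x ] ∷ Γ ⊢ Δ
⊢-eigenˡ {Γ} {Δ} {a} x A c a∉Γ a∉Δ a∉A D =
  subst₂ _⊢_ (cong₂ _∷_ (subF-eigen-inst c A x a∉A) (subL-eigen-id c Γ a∉Γ)) (subL-eigen-id c Δ a∉Δ)
             (⊢-sub (update fvar a c) D)

-- Cut admissibility

size : Formula → ℕ
size (atom _ _) = zero
size ⊤'         = zero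
size (A ∧' B)   = suc (size A + size B)
size (A ∨' B)   = suc (size A + size B)
size (A ⇒' B)   = suc (size A + size B)
size (∀' _ A)   = suc (size A)
size (∃' _ A)   = suc (size A)

size-[/] : ∀ φ u x → size (φ [ u / x ]) ≡ size φ
size-[/] (atom P ts) u x = refl
size-[/] ⊤'          u x = refl
size-[/] (A ∧' B)    u x = cong₂ (λ m n → suc (m + n)) (size-[/] A u x) (size-[/] B u x)
size-[/] (A ∨' B)    u x = cong₂ (λ m n → suc (m + n)) (size-[/] A u x) (size-[/] B u x)
size-[/] (A ⇒' B)    u x = cong₂ (λ m n → suc (m + n)) (size-[/] A u x) (size-[/] B u x)
size-[/] (∀' y A)    u x with y ≟ x
... | yes _ = refl
... | no _  = cong suc (size-[/] A u x)
size-[/] (∃' y A)    u x with y ≟ x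
... | yes _ = refl
... | no _  = cong suc (size-[/] A u x)

size-<ˡ : ∀ A B → size A < suc (size A + size B)
size-<ˡ A B = s≤s (m≤m+n (size A) (size B))

size-<ʳ : ∀ A B → size B < suc (size A + size B)
size-<ʳ A B = s≤s (m≤n+m (size B) (size A))

size-<-inst : ∀ A u x → size (A [ u / x ]) < suc (size A)
size-<-inst A u x = s≤s (≤-reflexive (size-[/] A u x))

CutBelow : Formula → Set
CutBelow φ = ∀ {ψ Γ Δ} → size ψ < size φ → Γ ⊢ ψ ∷ Δ → ψ ∷ Γ ⊢ Δ → Γ ⊢ Δ

-- The premises of a right rule introducing φ; atoms have no right rule.
Reduct : Formula → List Formula → List Formula → Set
Reduct (atom _ _) Γ Δ = ⊥
Reduct ⊤'         Γ Δ = ⊤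
Reduct (A ∧' B)   Γ Δ = Γ ⊢ A ∷ Δ × Γ ⊢ B ∷ Δ
Reduct (A ∨' B)   Γ Δ = Γ ⊢ A ∷ B ∷ Δ
Reduct (A ⇒' B)   Γ Δ = Γ ⊢ B ∷ Δ
Reduct (∀' x A)   Γ Δ = ∀ u → Γ ⊢ A [ u / x ] ∷ Δ
Reduct (∃' x A)   Γ Δ = Σ Param (λ u → Γ ⊢ A [ u / x ] ∷ Δ)

Reduct-weaken : ∀ φ {Γ Δ Γ' Δ'} → Γ ⊆ Γ' → Δ ⊆ Δ' → Reduct φ Γ Δ → Reduct φ Γ' Δ'
Reduct-weaken (atom _ _) Γ⊆ Δ⊆ ()
Reduct-weaken ⊤'         Γ⊆ Δ⊆ tt      = tt
Reduct-weaken (A ∧' B)   Γ⊆ Δ⊆ (D , E) = ⊢-weaken Γ⊆ (∷⁺ʳ _ Δ⊆) D , ⊢-weaken Γ⊆ (∷⁺ʳ _ Δ⊆) E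
Reduct-weaken (A ∨' B)   Γ⊆ Δ⊆ D       = ⊢-weaken Γ⊆ (∷⁺ʳ _ (∷⁺ʳ _ Δ⊆)) D
Reduct-weaken (A ⇒' B)   Γ⊆ Δ⊆ D       = ⊢-weaken Γ⊆ (∷⁺ʳ _ Δ⊆) D
Reduct-weaken (∀' x A)   Γ⊆ Δ⊆ F       = λ u → ⊢-weaken Γ⊆ (∷⁺ʳ _ Δ⊆) (F u)
Reduct-weaken (∃' x A)   Γ⊆ Δ⊆ (u , D) = u , ⊢-weaken Γ⊆ (∷⁺ʳ _ Δ⊆) D

introduceʳ : ∀ φ {Γ Δ} → φ ∈ Δ → Reduct φ Γ Δ → Γ ⊢ Δ
introduceʳ (atom _ _) k ()
introduceʳ ⊤'         k tt      = ⊤R k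
introduceʳ (A ∧' B)   k (D , E) = ∧R k D E
introduceʳ (A ∨' B)   k D       = ∨R k D
introduceʳ (A ⇒' B)   k D       = ⇒R k D
introduceʳ (∀' x A)   k F       = ∀R k F
introduceʳ (∃' x A)   k (u , D) = ∃R k u D

-- Induction on the derivation using φ; the inclusion Γ₀ ⊆ φ ∷ Γ absorbs the copies of φ that its
-- rules keep in the context.
cutʳ : ∀ {φ Γ Δ Γ₀} → CutBelow φ → Reduct φ Γ Δ → Γ₀ ⊢ Δ → Γ₀ ⊆ φ ∷ Γ → Γ ⊢ Δ
cutʳ {φ} ih r (ax m k) s with s m
... | here refl = introduceʳ φ k r
... | there m'  = ax m' k
cutʳ ih r (⊤R k) s = ⊤R k
cutʳ {φ} ih r (∧L m E) s with s m
... | there m' = ∧L m' (cutʳ ih (Reduct-weaken φ (there ∘ there) ⊆-refl r) E (∷-extend-⊆ (∷-extend-⊆ s)))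
cutʳ {A ∧' B} ih (r₁ , r₂) (∧L m E) s | here refl =
  ih (size-<ʳ A B) r₂ (ih (size-<ˡ A B) (⊢-weakenˡ there r₁) E')
  where E' = cutʳ ih (Reduct-weaken (A ∧' B) (there ∘ there) ⊆-refl (r₁ , r₂)) E (∷-extend-⊆ (∷-extend-⊆ s))
cutʳ {φ} ih r (∧R k E₁ E₂) s =
  ∧R k (cutʳ ih (Reduct-weaken φ ⊆-refl there r) E₁ s) (cutʳ ih (Reduct-weaken φ ⊆-refl there r) E₂ s)
cutʳ {φ} ih r (∨L m E₁ E₂) s with s m
... | there m' = ∨L m' (cutʳ ih (Reduct-weaken φ there ⊆-refl r) E₁ (∷-extend-⊆ s))
                       (cutʳ ih (Reduct-weaken φ there ⊆-refl r) E₂ (∷-extend-⊆ s))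
cutʳ {A ∨' B} ih r (∨L m E₁ E₂) s | here refl =
  ih (size-<ˡ A B) (ih (size-<ʳ A B) (⊢-weakenʳ ∷-swap-⊆ r) (⊢-weakenʳ there E₂')) E₁'
  where
  E₁' = cutʳ ih (Reduct-weaken (A ∨' B) there ⊆-refl r) E₁ (∷-extend-⊆ s)
  E₂' = cutʳ ih (Reduct-weaken (A ∨' B) there ⊆-refl r) E₂ (∷-extend-⊆ s)
cutʳ {φ} ih r (∨R k E) s = ∨R k (cutʳ ih (Reduct-weaken φ ⊆-refl (there ∘ there) r) E s)
cutʳ {φ} ih r (⇒L m E₁ E₂) s with s m
... | there m' = ⇒L m' (cutʳ ih (Reduct-weaken φ there ⊆-refl r) E₁ (∷-extend-⊆ s))
                       (cutʳ ih (Reduct-weaken φ ⊆-refl there r) E₂ s)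
cutʳ {A ⇒' B} ih r (⇒L m E₁ E₂) s | here refl =
  ih (size-<ʳ A B) r (cutʳ ih (Reduct-weaken (A ⇒' B) there ⊆-refl r) E₁ (∷-extend-⊆ s))
cutʳ {φ} ih r (⇒R k E) s = ⇒R k (cutʳ ih (Reduct-weaken φ ⊆-refl there r) E s)
cutʳ {φ} ih r (∀R k F) s = ∀R k (λ u → cutʳ ih (Reduct-weaken φ ⊆-refl there r) (F u) s)
cutʳ {φ} ih r (∃R k u E) s = ∃R k u (cutʳ ih (Reduct-weaken φ ⊆-refl there r) E s)
cutʳ {φ} ih r (∀L m u E) s with s m
... | there m' = ∀L m' u (cutʳ ih (Reduct-weaken φ there ⊆-refl r) E (∷-extend-⊆ s))
cutʳ {∀' x A} ih r (∀L m u E) s | here refl =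
  ih (size-<-inst A u x) (r u) (cutʳ ih (Reduct-weaken (∀' x A) there ⊆-refl r) E (∷-extend-⊆ s))
cutʳ {φ} ih r (∃L m F) s with s m
... | there m' = ∃L m' (λ u → cutʳ ih (Reduct-weaken φ there ⊆-refl r) (F u) (∷-extend-⊆ s))
cutʳ {∃' x A} ih (u , r) (∃L m F) s | here refl =
  ih (size-<-inst A u x) r (cutʳ ih (Reduct-weaken (∃' x A) there ⊆-refl (u , r)) (F u) (∷-extend-⊆ s))

reintroduce-or-cut : ∀ {φ ψ Γ Δ} → CutBelow φ → ψ ∈ φ ∷ Δ → Reduct ψ Γ Δ → φ ∷ Γ ⊢ Δ → Γ ⊢ Δ
reintroduce-or-cut ih (here refl) r E = cutʳ ih r E ⊆-refl
reintroduce-or-cut {ψ = ψ} ih (there k) r E = introduceʳ ψ k r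

cutˡ : ∀ {φ Γ Δ Δ₀} → CutBelow φ → Γ ⊢ Δ₀ → Δ₀ ⊆ φ ∷ Δ → φ ∷ Γ ⊢ Δ → Γ ⊢ Δ
cutˡ ih (ax m k) t E with t k
... | here refl = ⊢-weakenˡ (∷-contract-⊆ m) E
... | there k'  = ax m k'
cutˡ ih (⊤R k) t E = reintroduce-or-cut ih (t k) tt E
cutˡ ih (∧L m D) t E = ∧L m (cutˡ ih D t (⊢-weakenˡ (∷⁺ʳ _ (there ∘ there)) E))
cutˡ ih (∨L m D₁ D₂) t E = ∨L m (cutˡ ih D₁ t (⊢-weakenˡ (∷⁺ʳ _ there) E)) (cutˡ ih D₂ t (⊢-weakenˡ (∷⁺ʳ _ there) E))
cutˡ ih (⇒L m D₁ D₂) t E = ⇒L m (cutˡ ih D₁ t (⊢-weakenˡ (∷⁺ʳ _ there) E)) (cutˡ ih D₂ (∷-extend-⊆ t) (⊢-weakenʳ there E))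
cutˡ ih (∀L m u D) t E = ∀L m u (cutˡ ih D t (⊢-weakenˡ (∷⁺ʳ _ there) E))
cutˡ ih (∃L m F) t E = ∃L m (λ u → cutˡ ih (F u) t (⊢-weakenˡ (∷⁺ʳ _ there) E))
cutˡ ih (∧R k D₁ D₂) t E =
  reintroduce-or-cut ih (t k) (cutˡ ih D₁ (∷-extend-⊆ t) (⊢-weakenʳ there E) , cutˡ ih D₂ (∷-extend-⊆ t) (⊢-weakenʳ there E)) E
cutˡ ih (∨R k D) t E = reintroduce-or-cut ih (t k) (cutˡ ih D (∷-extend-⊆ (∷-extend-⊆ t)) (⊢-weakenʳ (there ∘ there) E)) E
cutˡ ih (⇒R k D) t E = reintroduce-or-cut ih (t k) (cutˡ ih D (∷-extend-⊆ t) (⊢-weakenʳ there E)) E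
cutˡ ih (∀R k F) t E = reintroduce-or-cut ih (t k) (λ u → cutˡ ih (F u) (∷-extend-⊆ t) (⊢-weakenʳ there E)) E
cutˡ ih (∃R k u D) t E = reintroduce-or-cut ih (t k) (u , cutˡ ih D (∷-extend-⊆ t) (⊢-weakenʳ there E)) E

cut-acc : ∀ {φ Γ Δ} → Acc _<_ (size φ) → Γ ⊢ φ ∷ Δ → φ ∷ Γ ⊢ Δ → Γ ⊢ Δ
cut-acc (acc rs) D E = cutˡ (λ lt → cut-acc (rs lt)) D ⊆-refl E

⊢-cut : ∀ {φ Γ Δ} → Γ ⊢ φ ∷ Δ → φ ∷ Γ ⊢ Δ → Γ ⊢ Δ
⊢-cut = cut-acc (<-wellFounded _)

-- Translations between QGPM and the auxiliary calculus

QGPM⇒⊢ : ∀ {c Γ Δ} → QGPM c Γ Δ → Γ ⊢ Δ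
QGPM⇒⊢ (set-eq Γ≈ Δ≈ D) = ⊢-weaken (SameSet⇒⊆ Γ≈) (SameSet⇒⊆ Δ≈) (QGPM⇒⊢ D)
QGPM⇒⊢ (ax _)     = ax (here refl) (here refl)
QGPM⇒⊢ ax⊤        = ⊤R (here refl)
QGPM⇒⊢ (∧L D)     = ∧L (here refl) (⊢-weakenˡ (∷⁺ʳ _ (∷⁺ʳ _ there)) (QGPM⇒⊢ D))
QGPM⇒⊢ (∧R D E)   = ∧R (here refl) (⊢-weakenʳ (∷⁺ʳ _ there) (QGPM⇒⊢ D)) (⊢-weakenʳ (∷⁺ʳ _ there) (QGPM⇒⊢ E))
QGPM⇒⊢ (∨L D E)   = ∨L (here refl) (⊢-weakenˡ (∷⁺ʳ _ there) (QGPM⇒⊢ D)) (⊢-weakenˡ (∷⁺ʳ _ there) (QGPM⇒⊢ E))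
QGPM⇒⊢ (∨R D)     = ∨R (here refl) (⊢-weakenʳ (∷⁺ʳ _ (∷⁺ʳ _ there)) (QGPM⇒⊢ D))
QGPM⇒⊢ (⇒L D E)   = ⇒L (here refl) (⊢-weakenˡ (∷⁺ʳ _ there) (QGPM⇒⊢ D)) (⊢-weakenˡ there (QGPM⇒⊢ E))
QGPM⇒⊢ (⇒Rp _ D)  = ⇒R (here refl) (⊢-weakenʳ (∷⁺ʳ _ there) (QGPM⇒⊢ D))
QGPM⇒⊢ (∀R {x = x} {φ = A} a∉Γ a∉Δ a∉∀ D) =
  ∀R (here refl) (λ c → ⊢-weakenʳ (∷⁺ʳ _ there) (⊢-eigenʳ x A c a∉Γ a∉Δ (a∉∀ ∘ ∀o) (QGPM⇒⊢ D)))
QGPM⇒⊢ (∀L u D)   = ∀L (here refl) u (⊢-weakenˡ (∷⁺ʳ _ there) (QGPM⇒⊢ D))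
QGPM⇒⊢ (∃R u D)   = ∃R (here refl) u (⊢-weakenʳ (∷⁺ʳ _ there) (QGPM⇒⊢ D))
QGPM⇒⊢ (∃L {x = x} {φ = A} a∉ a∉Δ D) =
  ∃L (here refl) (λ c → ⊢-weakenˡ (∷⁺ʳ _ there) (⊢-eigenˡ x A c (a∉ ∘ there) a∉Δ (a∉ ∘ here ∘ ∃o) (QGPM⇒⊢ D)))
QGPM⇒⊢ (weak _ _ _ _ D) = ⊢-weaken ∈-++⁺ˡ ∈-++⁺ˡ (QGPM⇒⊢ D)
QGPM⇒⊢ (cut {Γ = Γ} {Δ = Δ} _ _ D E) =
  ⊢-cut (⊢-weaken ∈-++⁺ˡ (∷⁺ʳ _ ∈-++⁺ˡ) (QGPM⇒⊢ D)) (⊢-weaken (∷⁺ʳ _ (∈-++⁺ʳ Γ)) (∈-++⁺ʳ Δ) (QGPM⇒⊢ E))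

-- A rule of _⊢_ is a QGPM rule followed by contracting its principal formula into the context.
⊢⇒QGPM : ∀ {Γ Δ} → Γ ⊢ Δ → All IsFormula Γ → All IsFormula Δ → QGPM false Γ Δ
⊢⇒QGPM {Γ} {Δ} (ax m k) wΓ wΔ =
  set-eq (SameSet-absorb m) (SameSet-absorb k) (weak Γ Δ wΓ wΔ (ax (All.lookup wΓ m)))
⊢⇒QGPM {Γ} {Δ} (⊤R k) wΓ wΔ = set-eq SameSet-refl (SameSet-absorb k) (weak Γ Δ wΓ wΔ ax⊤)
⊢⇒QGPM (∧L m D) wΓ wΔ with All.lookup wΓ m
... | ∧c a b = set-eq (SameSet-absorb m) SameSet-refl (∧L (⊢⇒QGPM D (a ∷ b ∷ wΓ) wΔ))
⊢⇒QGPM (∧R k D E) wΓ wΔ with All.lookup wΔ k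
... | ∧c a b = set-eq SameSet-refl (SameSet-absorb k) (∧R (⊢⇒QGPM D wΓ (a ∷ wΔ)) (⊢⇒QGPM E wΓ (b ∷ wΔ)))
⊢⇒QGPM (∨L m D E) wΓ wΔ with All.lookup wΓ m
... | ∨c a b = set-eq (SameSet-absorb m) SameSet-refl (∨L (⊢⇒QGPM D (a ∷ wΓ) wΔ) (⊢⇒QGPM E (b ∷ wΓ) wΔ))
⊢⇒QGPM (∨R k D) wΓ wΔ with All.lookup wΔ k
... | ∨c a b = set-eq SameSet-refl (SameSet-absorb k) (∨R (⊢⇒QGPM D wΓ (a ∷ b ∷ wΔ)))
⊢⇒QGPM (⇒L m D E) wΓ wΔ with All.lookup wΓ m
... | ⇒c a b = set-eq (SameSet-absorb m) SameSet-refl (⇒L (⊢⇒QGPM D (b ∷ wΓ) wΔ) (⊢⇒QGPM E wΓ (a ∷ wΔ)))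
⊢⇒QGPM (⇒R k D) wΓ wΔ with All.lookup wΔ k
... | ⇒c a b = set-eq SameSet-refl (SameSet-absorb k) (⇒Rp a (⊢⇒QGPM D wΓ (b ∷ wΔ)))
⊢⇒QGPM {Γ} {Δ} (∀R {x = x} {A} k F) wΓ wΔ with All.lookup wΔ k | fresh₂ Γ Δ
... | ∀c w | a , a∉Γ , a∉Δ = set-eq SameSet-refl (SameSet-absorb k)
  (∀R a∉Γ a∉Δ (a∉Δ ∘ lose k) (⊢⇒QGPM (F (fvar a)) wΓ (ClosedUnder-subst⁺ [] x (fvar a) A w ∷ wΔ)))
⊢⇒QGPM (∀L {x = x} {A} m u D) wΓ wΔ with All.lookup wΓ m
... | ∀c w = set-eq (SameSet-absorb m) SameSet-refl (∀L u (⊢⇒QGPM D (ClosedUnder-subst⁺ [] x u A w ∷ wΓ) wΔ))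
⊢⇒QGPM (∃R {x = x} {A} k u D) wΓ wΔ with All.lookup wΔ k
... | ∃c w = set-eq SameSet-refl (SameSet-absorb k) (∃R u (⊢⇒QGPM D wΓ (ClosedUnder-subst⁺ [] x u A w ∷ wΔ)))
⊢⇒QGPM {Γ} {Δ} (∃L {x = x} {A} m F) wΓ wΔ with All.lookup wΓ m | fresh₂ Γ Δ
... | ∃c w | a , a∉Γ , a∉Δ = set-eq (SameSet-absorb m) SameSet-refl
  (∃L (λ { (here o) → a∉Γ (lose m o) ; (there o) → a∉Γ o }) a∉Δ
      (⊢⇒QGPM (F (fvar a)) (ClosedUnder-subst⁺ [] x (fvar a) A w ∷ wΓ) wΔ))

QGPM-false⇒true : ∀ {Γ Δ} → QGPM false Γ Δ → QGPM true Γ Δ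
QGPM-false⇒true (set-eq Γ≈ Δ≈ D)   = set-eq Γ≈ Δ≈ (QGPM-false⇒true D)
QGPM-false⇒true (ax w)             = ax w
QGPM-false⇒true ax⊤                = ax⊤
QGPM-false⇒true (∧L D)             = ∧L (QGPM-false⇒true D)
QGPM-false⇒true (∧R D E)           = ∧R (QGPM-false⇒true D) (QGPM-false⇒true E)
QGPM-false⇒true (∨L D E)           = ∨L (QGPM-false⇒true D) (QGPM-false⇒true E)
QGPM-false⇒true (∨R D)             = ∨R (QGPM-false⇒true D)
QGPM-false⇒true (⇒L D E)           = ⇒L (QGPM-false⇒true D) (QGPM-false⇒true E)
QGPM-false⇒true (⇒Rp w D)          = ⇒Rp w (QGPM-false⇒true D)
QGPM-false⇒true (∀R a∉Γ a∉Δ a∉ D)  = ∀R a∉Γ a∉Δ a∉ (QGPM-false⇒true D)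
QGPM-false⇒true (∀L u D)           = ∀L u (QGPM-false⇒true D)
QGPM-false⇒true (∃R u D)           = ∃R u (QGPM-false⇒true D)
QGPM-false⇒true (∃L a∉ a∉Δ D)      = ∃L a∉ a∉Δ (QGPM-false⇒true D)
QGPM-false⇒true (weak Γ₁ Δ₁ w₁ w₂ D) = weak Γ₁ Δ₁ w₁ w₂ (QGPM-false⇒true D)
QGPM-false⇒true (cut () _ D E)

theorem1 : (Γ Δ : List Formula) → QGPM true Γ Δ ⇔ QGPM false Γ Δ
theorem1 Γ Δ = mk⇔ cut-free QGPM-false⇒true
  where
  cut-free : QGPM true Γ Δ → QGPM false Γ Δ
  cut-free D = let wΓ , wΔ = QGPM-wf D in ⊢⇒QGPM (QGPM⇒⊢ D) wΓ wΔ
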